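{- Let $G$ be a connected graph and let $e$ be an edge of $G$. Then $\frac{{\rm gp}(G)}{2}\le {\rm gp}(G-e)\le 2\,{\rm gp}(G)$. Moreover, both bounds are sharp: there exist graphs $G$ and edges $e$ with ${\rm gp}(G-e)={\rm gp}(G)/2$, and there exist graphs $G$ and edges $e$ with ${\rm gp}(G-e)=2\,{\rm gp}(G)$.
   Context: All graphs are simple. A set $X\subseteq V(G)$ is a general position set of $G$ if for every pair of distinct $u,v\in X$ and every shortest $u,v$-path $P$ in $G$ we have $V(P)\cap X=\{u,v\}$ (vertices in different components impose no condition). ${\rm gp}(G)$ is the maximum cardinality of a general position set of $G$. $G-e$ is the graph obtained from $G$ by deleting the edge $e$. -}

module Defs where

open import Data.Nat using (ℕ; zero; suc; _≤_)
open import Data.Fin using (Fin; _≟_)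
open import Data.Fin.Subset using (Subset; _∈_; ∣_∣)
open import Data.Bool using (Bool; true; false; _∧_; _∨_; not)
open import Data.Bool.Properties using (∧-comm; ∨-comm; ∧-zeroʳ)
open import Data.Product using (Σ; ∃; _×_; _,_)
open import Data.Sum using (_⊎_)
open import Relation.Nullary using (¬_)
open import Relation.Nullary.Decidable using (⌊_⌋)
open import Relation.Binary.PropositionalEquality using (_≡_; _≢_; refl; cong; cong₂)

record Graph : Set where
  field
    n   : ℕ
    adj : Fin n → Fin n → Bool
    sym : ∀ i j → adj i j ≡ adj j i
    irr : ∀ i → adj i i ≡ false
open Graph public

Vertex : Graph → Set
Vertex G = Fin (n G)

data Walk (G : Graph) : Vertex G → Vertex G → ℕ → Set where
  here : ∀ {u} → Walk G u u zero
  step : ∀ {u w v ℓ} → adj G u w ≡ true → Walk G w v ℓ → Walk G u v (suc ℓ)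

data OnWalk {G : Graph} (x : Vertex G) : ∀ {u v ℓ} → Walk G u v ℓ → Set where
  on-here  : OnWalk x (here {G} {x})
  on-start : ∀ {w v ℓ} {a : adj G x w ≡ true} {W : Walk G w v ℓ} → OnWalk x (step a W)
  on-later : ∀ {u w v ℓ} {a : adj G u w ≡ true} {W : Walk G w v ℓ} →
             OnWalk x W → OnWalk x (step a W)

-- A shortest u,v-walk: no u,v-walk is shorter.  (A shortest walk is a path.)
IsShortest : (G : Graph) {u v : Vertex G} {ℓ : ℕ} → Walk G u v ℓ → Set
IsShortest G {u} {v} {ℓ} _ = ∀ {ℓ'} → Walk G u v ℓ' → ℓ ≤ ℓ'

Connected : Graph → Set
Connected G = ∀ (u v : Vertex G) → ∃ λ ℓ → Walk G u v ℓ

GenPos : (G : Graph) → Subset (n G) → Set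
GenPos G X = ∀ (u v : Vertex G) → u ∈ X → v ∈ X → u ≢ v →
  ∀ {ℓ} (P : Walk G u v ℓ) → IsShortest G P →
  ∀ (w : Vertex G) → OnWalk w P → w ∈ X → (w ≡ u) ⊎ (w ≡ v)

IsGP : Graph → ℕ → Set
IsGP G k = (Σ (Subset (n G)) λ X → GenPos G X × ∣ X ∣ ≡ k)
         × (∀ (X : Subset (n G)) → GenPos G X → ∣ X ∣ ≤ k)

IsEdge : (G : Graph) → Vertex G → Vertex G → Set
IsEdge G a b = adj G a b ≡ true

private
  eqb : ∀ {m} → Fin m → Fin m → Bool
  eqb i j = ⌊ i ≟ j ⌋

  eqb-sym : ∀ {m} (i j : Fin m) → eqb i j ≡ eqb j i
  eqb-sym i j with i ≟ j | j ≟ i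
  ... | Relation.Nullary.yes _ | Relation.Nullary.yes _ = refl
  ... | Relation.Nullary.no _  | Relation.Nullary.no _  = refl
  ... | Relation.Nullary.yes refl | Relation.Nullary.no q = Data.Empty.⊥-elim (q refl)
    where import Data.Empty
  ... | Relation.Nullary.no q  | Relation.Nullary.yes refl = Data.Empty.⊥-elim (q refl)
    where import Data.Empty

  hit : ∀ {m} → Fin m → Fin m → Fin m → Fin m → Bool
  hit a b i j = (eqb i a ∧ eqb j b) ∨ (eqb i b ∧ eqb j a)

  hit-sym : ∀ {m} (a b i j : Fin m) → hit a b i j ≡ hit a b j i
  hit-sym a b i j
    rewrite ∧-comm (eqb i a) (eqb j b) | ∧-comm (eqb i b) (eqb j a)
    = ∨-comm (eqb j b ∧ eqb i a) (eqb j a ∧ eqb i b)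

deleteEdge : (G : Graph) → Vertex G → Vertex G → Graph
deleteEdge G a b = record
  { n   = n G
  ; adj = λ i j → adj G i j ∧ not (hit a b i j)
  ; sym = λ i j → cong₂ (λ x y → x ∧ not y) (sym G i j) (hit-sym a b i j)
  ; irr = λ i → cong (λ x → x ∧ not (hit a b i i)) (irr G i)
  }

{-# OPTIONS --safe #-}
-- Split the vertices by whether they are at least as close to a as to b. A geodesic of G that
-- uses the edge ab, say from a to b, starts strictly closer to a and ends strictly closer to b:
-- otherwise rerouting through a geodesic to the nearer endpoint would be shorter. Hence
-- geodesics of G between two vertices on the same side avoid ab, so they are exactly the
-- geodesics of G - ab, and a one-sided set is in general position in G iff it is in G - ab.
-- Each side of a general position set of one graph therefore has at most the gp-number of the
-- other. Sharpness is checked on P₄ with its middle edge deleted and on a 5-cycle with pendant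
-- vertices at the ends of the deleted edge, both by finite computation against distance tables.
module Submission where

open import Defs
open import Data.Bool using (Bool; true; false; _∧_; _∨_)
import Data.Bool.Properties as Bool
open import Data.Empty using (⊥-elim)
open import Data.Fin using (Fin; _≟_; #_; toℕ)
open import Data.Fin.Properties using (any?; all?)
open import Data.Fin.Subset using (Subset; _∈_; _∉_; _⊆_; _∩_; ∁; ∣_∣; inside; outside)
open import Data.Fin.Subset.Properties using (_∈?_; p∩q⊆p; x∈p∩q⁻; x∈∁p⇒x∉p)
open import Data.List using (List; []; _∷_)
open import Data.Bool.ListAction using (any)
open import Data.Nat using (ℕ; zero; suc; s≤s; _+_; _*_; _≤_; _<_; _≤?_; ∣_-_∣)
import Data.Nat.Properties as ℕ
open import Data.Nat.Induction using (<-rec)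
open import Data.Product using (Σ; ∃; _×_; _,_; proj₂)
open import Data.Sum using (_⊎_; inj₁; inj₂)
open import Data.Vec using (Vec; []; _∷_; lookup; tabulate)
open import Data.Vec.Properties using (lookup∘tabulate; []=⇒lookup; lookup⇒[]=)
open import Function using (_∘_)
open import Relation.Nullary using (¬_; Dec; yes; no; does; _×-dec_; _→-dec_; ¬?)
open import Relation.Nullary.Decidable using (True; toWitness; from-yes; dec-true; ⌊_⌋)
import Relation.Nullary.Decidable as Dec
open import Relation.Unary using (Pred; Decidable)
open import Relation.Binary.PropositionalEquality using (_≡_; _≢_; refl; trans; subst; cong) renaming (sym to ≡-sym)

module _ {G : Graph} where

  infixr 5 _++_

  _++_ : ∀ {u w v i j} → Walk G u w i → Walk G w v j → Walk G u v (i + j)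
  here     ++ Q = Q
  step a P ++ Q = step a (P ++ Q)

  onWalk-++ʳ : ∀ {x u w v i j} (P : Walk G u w i) {Q : Walk G w v j} →
               OnWalk x Q → OnWalk x (P ++ Q)
  onWalk-++ʳ here       x∈Q = x∈Q
  onWalk-++ʳ (step a P) x∈Q = on-later (onWalk-++ʳ P x∈Q)

  onWalk-start : ∀ {u v ℓ} (P : Walk G u v ℓ) → OnWalk u P
  onWalk-start here       = on-here
  onWalk-start (step a P) = on-start

  splitAt : ∀ {x u v ℓ} {P : Walk G u v ℓ} → OnWalk x P →
            Σ ℕ λ i → Σ ℕ λ j → i + j ≡ ℓ × Walk G u x i × Walk G x v j
  splitAt on-here                    = 0 , 0 , refl , here , here
  splitAt (on-start {a = a} {W = W}) = 0 , _ , refl , here , step a W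
  splitAt (on-later {a = a} x∈P) with splitAt x∈P
  ... | i , j , refl , P₁ , P₂ = suc i , j , refl , step a P₁ , P₂

  snoc : ∀ {u w v ℓ} → Walk G u w ℓ → adj G w v ≡ true → Walk G u v (suc ℓ)
  snoc here       a = step a here
  snoc (step b P) a = step b (snoc P a)

  reverse : ∀ {u v ℓ} → Walk G u v ℓ → Walk G v u ℓ
  reverse here                   = here
  reverse {u} (step {w = w} a P) = snoc (reverse P) (trans (Graph.sym G w u) a)

  walk? : ∀ ℓ u v → Dec (Walk G u v ℓ)
  walk? zero u v with u ≟ v
  ... | yes refl = yes here
  ... | no u≢v   = no λ { here → u≢v refl }
  walk? (suc ℓ) u v with any? (λ w → (adj G u w Bool.≟ true) ×-dec walk? ℓ w v)
  ... | yes (w , a , P) = yes (step a P)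
  ... | no ∄w           = no λ { (step a P) → ∄w (_ , a , P) }

  genPos-⊆ : ∀ {X Y} → Y ⊆ X → GenPos G X → GenPos G Y
  genPos-⊆ Y⊆X X-gp u v u∈Y v∈Y u≢v P P-short w w∈P w∈Y =
    X-gp u v (Y⊆X u∈Y) (Y⊆X v∈Y) u≢v P P-short w w∈P (Y⊆X w∈Y)

record Geodesic (G : Graph) (u v : Vertex G) : Set where
  constructor geodesic
  field
    {len}    : ℕ
    walk     : Walk G u v len
    shortest : IsShortest G walk
open Geodesic

shorten : ∀ {G : Graph} {u v} L → Walk G u v L → Geodesic G u v
shorten {G} {u} {v} = <-rec (λ L → Walk G u v L → Geodesic G u v) go
  where
  go : ∀ L → (∀ {ℓ} → ℓ < L → Walk G u v ℓ → Geodesic G u v) → Walk G u v L → Geodesic G u v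
  go L rec P with ℕ.anyUpTo? (λ ℓ → walk? ℓ u v) L
  ... | yes (ℓ , ℓ<L , Q) = rec ℓ<L Q
  ... | no  ∄shorter      = geodesic P λ Q → ℕ.≮⇒≥ λ ℓ<L → ∄shorter (_ , ℓ<L , Q)

data Crossing (G : Graph) (x y u v : Vertex G) : ℕ → Set where
  crossing : ∀ {i j} → Walk G u x i → Walk G y v j → Crossing G x y u v (suc (i + j))

module Distance (G : Graph) (conn : Connected G) where

  geodesicBetween : ∀ u v → Geodesic G u v
  geodesicBetween u v = shorten _ (proj₂ (conn u v))

  d : Vertex G → Vertex G → ℕ
  d u v = len (geodesicBetween u v)

  d-minimal : ∀ {u v ℓ} → Walk G u v ℓ → d u v ≤ ℓ
  d-minimal = shortest (geodesicBetween _ _)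

  crossing-geodesic : ∀ {x y u v ℓ} (P : Walk G u v ℓ) → IsShortest G P → Crossing G x y u v ℓ →
                      d u x < d u y × d v y < d v x
  crossing-geodesic {x} {y} {u} {v} _ P-short (crossing {i} {j} A B) =
      ℕ.≰⇒> (λ uy≤ux → ℕ.≤⇒≯ (P-short (walk (geodesicBetween u y) ++ B))
                         (s≤s (ℕ.+-monoˡ-≤ j (ℕ.≤-trans uy≤ux (d-minimal A)))))
    , ℕ.≰⇒> (λ vx≤vy → ℕ.≤⇒≯ (P-short (A ++ reverse (walk (geodesicBetween v x))))
                         (s≤s (ℕ.+-monoʳ-≤ i (ℕ.≤-trans vx≤vy (d-minimal (reverse B))))))

∧-trueˡ : ∀ {x y} → x ∧ y ≡ true → x ≡ true
∧-trueˡ {true} _ = refl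

module EdgeDeletion (G : Graph) (a b : Vertex G) where

  G-ab : Graph
  G-ab = deleteEdge G a b

  adj-deleteEdge : ∀ {u w} → adj G u w ≡ true →
                   (u ≡ a × w ≡ b) ⊎ (u ≡ b × w ≡ a) ⊎ adj G-ab u w ≡ true
  adj-deleteEdge {u} {w} uw with u ≟ a | w ≟ b | u ≟ b | w ≟ a
  ... | yes u≡a | yes w≡b | _       | _       = inj₁ (u≡a , w≡b)
  ... | _       | _       | yes u≡b | yes w≡a = inj₂ (inj₁ (u≡b , w≡a))
  -- In the remaining cases the test for the deleted edge computes to false.
  ... | no _    | _       | no _    | _       = inj₂ (inj₂ (trans (Bool.∧-identityʳ _) uw))
  ... | no _    | _       | yes _   | no _    = inj₂ (inj₂ (trans (Bool.∧-identityʳ _) uw))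
  ... | yes _   | no _    | no _    | _       = inj₂ (inj₂ (trans (Bool.∧-identityʳ _) uw))
  ... | yes _   | no _    | yes _   | no _    = inj₂ (inj₂ (trans (Bool.∧-identityʳ _) uw))

  lift : ∀ {u v ℓ} → Walk G-ab u v ℓ → Walk G u v ℓ
  lift here       = here
  lift (step p P) = step (∧-trueˡ p) (lift P)

  onWalk-lift : ∀ {x u v ℓ} {P : Walk G-ab u v ℓ} → OnWalk x P → OnWalk x (lift P)
  onWalk-lift on-here      = on-here
  onWalk-lift on-start     = on-start
  onWalk-lift (on-later o) = on-later (onWalk-lift o)

  Avoiding : ∀ {u v ℓ} → Walk G u v ℓ → Set
  Avoiding {u} {v} {ℓ} P = Σ (Walk G-ab u v ℓ) λ P′ → ∀ {x} → OnWalk x P → OnWalk x P′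

  data Route {u v ℓ} (P : Walk G u v ℓ) : Set where
    avoids     : Avoiding P → Route P
    crosses    : Crossing G a b u v ℓ → Route P
    crosses⁻¹  : Crossing G b a u v ℓ → Route P

  route : ∀ {u v ℓ} (P : Walk G u v ℓ) → Route P
  route here = avoids (here , λ { on-here → on-here })
  route (step uw P) with adj-deleteEdge uw | route P
  ... | inj₁ (refl , refl)        | _                       = crosses (crossing here P)
  ... | inj₂ (inj₁ (refl , refl)) | _                       = crosses⁻¹ (crossing here P)
  ... | inj₂ (inj₂ uw′)           | avoids (P′ , P⊆P′)      =
    avoids (step uw′ P′ , λ { on-start → on-start ; (on-later o) → on-later (P⊆P′ o) })
  ... | inj₂ (inj₂ _)             | crosses (crossing A B)  = crosses (crossing (step uw A) B)
  ... | inj₂ (inj₂ _)             | crosses⁻¹ (crossing A B) = crosses⁻¹ (crossing (step uw A) B)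

module _ {n p} {P : Pred (Fin n) p} (P? : Decidable P) where

  satisfying : Subset n
  satisfying = tabulate (does ∘ P?)

  ∈-satisfying⁺ : ∀ {x} → P x → x ∈ satisfying
  ∈-satisfying⁺ {x} px = lookup⇒[]= x satisfying (trans (lookup∘tabulate _ x) (dec-true (P? x) px))

  ∈-satisfying⁻ : ∀ {x} → x ∈ satisfying → P x
  ∈-satisfying⁻ {x} x∈ with P? x | trans (≡-sym (lookup∘tabulate (does ∘ P?) x)) ([]=⇒lookup x∈)
  ... | yes px | _ = px
  ... | no _   | ()

∣p∣≡∣p∩q∣+∣p∩∁q∣ : ∀ {n} (p q : Subset n) → ∣ p ∣ ≡ ∣ p ∩ q ∣ + ∣ p ∩ ∁ q ∣
∣p∣≡∣p∩q∣+∣p∩∁q∣ []            []            = refl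
∣p∣≡∣p∩q∣+∣p∩∁q∣ (outside ∷ p) (_ ∷ q)       = ∣p∣≡∣p∩q∣+∣p∩∁q∣ p q
∣p∣≡∣p∩q∣+∣p∩∁q∣ (inside ∷ p)  (inside ∷ q)  = cong suc (∣p∣≡∣p∩q∣+∣p∩∁q∣ p q)
∣p∣≡∣p∩q∣+∣p∩∁q∣ (inside ∷ p)  (outside ∷ q) =
  trans (cong suc (∣p∣≡∣p∩q∣+∣p∩∁q∣ p q)) (≡-sym (ℕ.+-suc _ _))

∣p∣≤2*m : ∀ {n m} (p q : Subset n) → ∣ p ∩ q ∣ ≤ m → ∣ p ∩ ∁ q ∣ ≤ m → ∣ p ∣ ≤ 2 * m
∣p∣≤2*m {m = m} p q p∩q≤m p∩∁q≤m = begin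
  ∣ p ∣                     ≡⟨ ∣p∣≡∣p∩q∣+∣p∩∁q∣ p q ⟩
  ∣ p ∩ q ∣ + ∣ p ∩ ∁ q ∣   ≤⟨ ℕ.+-mono-≤ p∩q≤m p∩∁q≤m ⟩
  m + m                     ≡⟨ cong (m +_) (≡-sym (ℕ.+-identityʳ m)) ⟩
  2 * m                     ∎
  where open ℕ.≤-Reasoning

module DeletionBounds (G : Graph) (conn : Connected G) (a b : Vertex G) where
  open Distance G conn
  open EdgeDeletion G a b

  nearA? : Decidable (λ x → d x a ≤ d x b)
  nearA? x = d x a ≤? d x b

  nearA : Subset (n G)
  nearA = satisfying nearA?

  closer-to-a : ∀ {x} → d x a < d x b → x ∈ nearA
  closer-to-a = ∈-satisfying⁺ nearA? ∘ ℕ.<⇒≤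

  closer-to-b : ∀ {x} → d x b < d x a → x ∉ nearA
  closer-to-b xb<xa = ℕ.<⇒≱ xb<xa ∘ ∈-satisfying⁻ nearA?

  OneSided : Subset (n G) → Set
  OneSided X = ∀ {u v} → u ∈ X → v ∈ X → u ∈ nearA → v ∈ nearA

  ∩nearA-oneSided : ∀ X → OneSided (X ∩ nearA)
  ∩nearA-oneSided X _ v∈ _ = proj₂ (x∈p∩q⁻ X nearA v∈)

  ∩∁nearA-oneSided : ∀ X → OneSided (X ∩ ∁ nearA)
  ∩∁nearA-oneSided X u∈ _ u∈A = ⊥-elim (x∈∁p⇒x∉p (proj₂ (x∈p∩q⁻ X _ u∈)) u∈A)

  geodesic-avoids : ∀ {X u v ℓ} (P : Walk G u v ℓ) → OneSided X → u ∈ X → v ∈ X →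
                    IsShortest G P → Avoiding P
  geodesic-avoids P X-one u∈X v∈X P-short with route P
  ... | avoids P-avoids = P-avoids
  ... | crosses c with crossing-geodesic P P-short c
  ...   | ua<ub , vb<va = ⊥-elim (closer-to-b vb<va (X-one u∈X v∈X (closer-to-a ua<ub)))
  geodesic-avoids P X-one u∈X v∈X P-short | crosses⁻¹ c with crossing-geodesic P P-short c
  ...   | ub<ua , va<vb = ⊥-elim (closer-to-b ub<ua (X-one v∈X u∈X (closer-to-a va<vb)))

  genPos-deleteEdge : ∀ {X} → OneSided X → GenPos G X → GenPos G-ab X
  genPos-deleteEdge X-one X-gp u v u∈X v∈X u≢v P P-short w w∈P w∈X =
    X-gp u v u∈X v∈X u≢v (lift P) lift-shortest w (onWalk-lift w∈P) w∈X
    where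
    lift-shortest : IsShortest G (lift P)
    lift-shortest Q with geodesic-avoids (walk (geodesicBetween u v)) X-one u∈X v∈X d-minimal
    ... | R , _ = ℕ.≤-trans (P-short R) (d-minimal Q)

  genPos-restoreEdge : ∀ {X} → OneSided X → GenPos G-ab X → GenPos G X
  genPos-restoreEdge X-one X-gp u v u∈X v∈X u≢v P P-short w w∈P w∈X
    with geodesic-avoids P X-one u∈X v∈X P-short
  ... | P′ , P⊆P′ = X-gp u v u∈X v∈X u≢v P′ (λ Q → P-short (lift Q)) w (P⊆P′ w∈P) w∈X

  ∣genPos∣≤2*gp-deleteEdge : ∀ {m} → (∀ Y → GenPos G-ab Y → ∣ Y ∣ ≤ m) →
                              ∀ X → GenPos G X → ∣ X ∣ ≤ 2 * m
  ∣genPos∣≤2*gp-deleteEdge max X X-gp = ∣p∣≤2*m X nearA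
    (max _ (genPos-deleteEdge (∩nearA-oneSided X) (genPos-⊆ (p∩q⊆p _ _) X-gp)))
    (max _ (genPos-deleteEdge (∩∁nearA-oneSided X) (genPos-⊆ (p∩q⊆p _ _) X-gp)))

  ∣genPos-deleteEdge∣≤2*gp : ∀ {k} → (∀ X → GenPos G X → ∣ X ∣ ≤ k) →
                              ∀ Y → GenPos G-ab Y → ∣ Y ∣ ≤ 2 * k
  ∣genPos-deleteEdge∣≤2*gp max Y Y-gp = ∣p∣≤2*m Y nearA
    (max _ (genPos-restoreEdge (∩nearA-oneSided Y) (genPos-⊆ (p∩q⊆p _ _) Y-gp)))
    (max _ (genPos-restoreEdge (∩∁nearA-oneSided Y) (genPos-⊆ (p∩q⊆p _ _) Y-gp)))

gp-deleteEdge-bounds : (G : Graph) → Connected G → (a b : Vertex G) →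
                       ∀ k m → IsGP G k → IsGP (deleteEdge G a b) m → k ≤ 2 * m × m ≤ 2 * k
gp-deleteEdge-bounds G conn a b _ _ ((X , X-gp , refl) , G-max) ((Y , Y-gp , refl) , G-ab-max) =
  ∣genPos∣≤2*gp-deleteEdge G-ab-max X X-gp , ∣genPos-deleteEdge∣≤2*gp G-max Y Y-gp
  where open DeletionBounds G conn a b

all-subsets? : ∀ {n p} {P : Pred (Subset n) p} → Decidable P → Dec (∀ X → P X)
all-subsets? {zero}  P? = Dec.map′ (λ P[] → λ { [] → P[] }) (λ ∀P → ∀P []) (P? [])
all-subsets? {suc n} P? =
  Dec.map′ (λ (P-in , P-out) → λ { (inside ∷ X) → P-in X ; (outside ∷ X) → P-out X })
           (λ ∀P → (λ X → ∀P (inside ∷ X)) , (λ X → ∀P (outside ∷ X)))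
           (all-subsets? (P? ∘ (inside ∷_)) ×-dec all-subsets? (P? ∘ (outside ∷_)))

-- δ u v is certified as the distance whenever component u ≡ component v: δ-self and δ-adj make
-- it a lower bound on walk lengths and δ-hop realises it.
module DistanceCertificate (G : Graph) (component : Vertex G → ℕ) (δ : Vertex G → Vertex G → ℕ) where

  Hop : Vertex G → Vertex G → ℕ → Set
  Hop u v zero    = u ≡ v
  Hop u v (suc k) = ∃ λ w → adj G u w ≡ true × δ w v ≡ k

  ComponentsRespectEdges Lipschitz : Set
  ComponentsRespectEdges = ∀ u w → adj G u w ≡ true → component u ≡ component w
  Lipschitz = ∀ u w v → adj G u w ≡ true → component u ≡ component v → δ u v ≤ suc (δ w v)

  Realised : Set
  Realised = ∀ u v → component u ≡ component v → Hop u v (δ u v)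

  record Valid : Set where
    field
      component-adj : ComponentsRespectEdges
      δ-self        : ∀ v → δ v v ≡ 0
      δ-adj         : Lipschitz
      δ-hop         : Realised

  valid? : Dec Valid
  valid? = Dec.map′ (λ (c , s , a , h) → record { component-adj = c ; δ-self = s ; δ-adj = a ; δ-hop = h })
                    (λ V → let open Valid V in component-adj , δ-self , δ-adj , δ-hop)
                    (component-adj? ×-dec (all? λ v → δ v v ℕ.≟ 0) ×-dec δ-adj? ×-dec δ-hop?)
    where
    adj? : ∀ u w → Dec (adj G u w ≡ true)
    adj? u w = adj G u w Bool.≟ true

    hop? : ∀ u v k → Dec (Hop u v k)
    hop? u v zero    = u ≟ v
    hop? u v (suc k) = any? λ w → adj? u w ×-dec δ w v ℕ.≟ k

    component-adj? : Dec ComponentsRespectEdges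
    component-adj? = all? λ u → all? λ w → adj? u w →-dec component u ℕ.≟ component w

    δ-adj? : Dec Lipschitz
    δ-adj? = all? λ u → all? λ w → all? λ v →
             adj? u w →-dec component u ℕ.≟ component v →-dec δ u v ≤? suc (δ w v)

    δ-hop? : Dec Realised
    δ-hop? = all? λ u → all? λ v → component u ℕ.≟ component v →-dec hop? u v (δ u v)

  NoneBetween : Subset (n G) → Set
  NoneBetween X = ∀ u v w → u ∈ X → v ∈ X → w ∈ X → u ≢ v → w ≢ u → w ≢ v →
                  component u ≡ component w → component w ≡ component v → ¬ δ u w + δ w v ≤ δ u v

  noneBetween? : ∀ X → Dec (NoneBetween X)
  noneBetween? X = all? λ u → all? λ v → all? λ w →
    u ∈? X →-dec v ∈? X →-dec w ∈? X →-dec ¬? (u ≟ v) →-dec ¬? (w ≟ u) →-dec ¬? (w ≟ v) →-dec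
    component u ℕ.≟ component w →-dec component w ℕ.≟ component v →-dec ¬? (δ u w + δ w v ≤? δ u v)

  noneBetween-bounded? : ∀ k → Dec (∀ X → NoneBetween X → ∣ X ∣ ≤ k)
  noneBetween-bounded? k = all-subsets? λ X → noneBetween? X →-dec ∣ X ∣ ≤? k

  module _ (valid : Valid) where
    open Valid valid

    component-walk : ∀ {u v ℓ} → Walk G u v ℓ → component u ≡ component v
    component-walk here        = refl
    component-walk (step uw P) = trans (component-adj _ _ uw) (component-walk P)

    δ-minimal : ∀ {u v ℓ} → Walk G u v ℓ → δ u v ≤ ℓ
    δ-minimal {v = v} here = ℕ.≤-reflexive (δ-self v)
    δ-minimal (step uw P) = ℕ.≤-trans (δ-adj _ _ _ uw (component-walk (step uw P))) (s≤s (δ-minimal P))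

    hop-walk : ∀ k {u v} → component u ≡ component v → Hop u v k → Walk G u v k
    hop-walk zero            _  refl                 = here
    hop-walk (suc k) {u} {v} uv (w , uw , wv-length) =
      step uw (hop-walk k wv (subst (Hop w v) wv-length (δ-hop w v wv)))
      where
      wv : component w ≡ component v
      wv = trans (≡-sym (component-adj u w uw)) uv

    δ-walk : ∀ {u v} → component u ≡ component v → Walk G u v (δ u v)
    δ-walk {u} {v} uv = hop-walk (δ u v) uv (δ-hop u v uv)

    connected : (∀ u v → component u ≡ component v) → Connected G
    connected same u v = δ u v , δ-walk (same u v)

    genPos⇒noneBetween : ∀ {X} → GenPos G X → NoneBetween X
    genPos⇒noneBetween X-gp u v w u∈X v∈X w∈X u≢v w≢u w≢v uw wv between
      with X-gp u v u∈X v∈X u≢v (δ-walk uw ++ δ-walk wv)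
                (λ Q → ℕ.≤-trans between (δ-minimal Q))
                w (onWalk-++ʳ (δ-walk uw) (onWalk-start (δ-walk wv))) w∈X
    ... | inj₁ w≡u = w≢u w≡u
    ... | inj₂ w≡v = w≢v w≡v

    noneBetween⇒genPos : ∀ {X} → NoneBetween X → GenPos G X
    noneBetween⇒genPos X-nb u v u∈X v∈X u≢v P P-short w w∈P w∈X with w ≟ u | w ≟ v | splitAt w∈P
    ... | yes w≡u | _       | _ = inj₁ w≡u
    ... | no _    | yes w≡v | _ = inj₂ w≡v
    ... | no w≢u  | no w≢v  | i , j , refl , P₁ , P₂ =
      ⊥-elim (X-nb u v w u∈X v∈X w∈X u≢v w≢u w≢v (component-walk P₁) (component-walk P₂)
        (ℕ.≤-trans (ℕ.+-mono-≤ (δ-minimal P₁) (δ-minimal P₂))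
                   (P-short (δ-walk (component-walk P)))))

    isGP : ∀ X → NoneBetween X → (∀ Y → NoneBetween Y → ∣ Y ∣ ≤ ∣ X ∣) → IsGP G ∣ X ∣
    isGP X X-nb max =
      (X , noneBetween⇒genPos X-nb , refl) , λ Y Y-gp → max Y (genPos⇒noneBetween Y-gp)

  connected-decided : {True valid?} → (∀ u v → component u ≡ component v) → Connected G
  connected-decided {valid} = connected (toWitness valid)

  isGP-decided : ∀ X → {True valid?} → {True (noneBetween? X)} →
                 {True (noneBetween-bounded? ∣ X ∣)} → IsGP G ∣ X ∣
  isGP-decided X {valid} {X-nb} {max} = isGP (toWitness valid) X (toWitness X-nb) (toWitness max)

fromEdges : ∀ {n} → List (Fin n × Fin n) → Fin n → Fin n → Bool
fromEdges E i j = any (λ (x , y) → (⌊ i ≟ x ⌋ ∧ ⌊ j ≟ y ⌋) ∨ (⌊ i ≟ y ⌋ ∧ ⌊ j ≟ x ⌋)) E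

symmetric? : ∀ {n} (A : Fin n → Fin n → Bool) → Dec (∀ i j → A i j ≡ A j i)
symmetric? A = all? λ i → all? λ j → A i j Bool.≟ A j i

irreflexive? : ∀ {n} (A : Fin n → Fin n → Bool) → Dec (∀ i → A i i ≡ false)
irreflexive? A = all? λ i → A i i Bool.≟ false

oneComponent : ∀ {n} → Fin n → ℕ
oneComponent _ = 0

pathDistance : ∀ {n} → (Fin n → ℕ) → Fin n → Fin n → ℕ
pathDistance position i j = ∣ position i - position j ∣

P₄ : Graph
P₄ = record { n = 4 ; adj = edges
            ; sym = from-yes (symmetric? edges) ; irr = from-yes (irreflexive? edges) }
  where
  edges : Fin 4 → Fin 4 → Bool
  edges = fromEdges ((# 0 , # 1) ∷ (# 1 , # 2) ∷ (# 2 , # 3) ∷ [])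

C₅-with-pendants : Graph
C₅-with-pendants = record { n = 7 ; adj = edges
                          ; sym = from-yes (symmetric? edges) ; irr = from-yes (irreflexive? edges) }
  where
  edges : Fin 7 → Fin 7 → Bool
  edges = fromEdges ((# 0 , # 1) ∷ (# 1 , # 4) ∷ (# 4 , # 6) ∷ (# 6 , # 2) ∷ (# 2 , # 0) ∷
                     (# 0 , # 3) ∷ (# 1 , # 5) ∷ [])

module _ where
  open DistanceCertificate P₄ oneComponent (pathDistance toℕ)

  P₄-connected : Connected P₄
  P₄-connected = connected-decided (λ _ _ → refl)

  gp-P₄ : IsGP P₄ 2
  gp-P₄ = isGP-decided (inside ∷ outside ∷ outside ∷ inside ∷ [])

gp-P₄-12 : IsGP (deleteEdge P₄ (# 1) (# 2)) 4
gp-P₄-12 = isGP-decided (inside ∷ inside ∷ inside ∷ inside ∷ [])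
  where
  components : Fin 4 → ℕ
  components i = lookup (0 ∷ 0 ∷ 1 ∷ 1 ∷ []) i
  open DistanceCertificate (deleteEdge P₄ (# 1) (# 2)) components (pathDistance toℕ)

module _ where
  C₅-with-pendants-distances : Vec (Vec ℕ 7) 7
  C₅-with-pendants-distances = (0 ∷ 1 ∷ 1 ∷ 1 ∷ 2 ∷ 2 ∷ 2 ∷ [])
                             ∷ (1 ∷ 0 ∷ 2 ∷ 2 ∷ 1 ∷ 1 ∷ 2 ∷ [])
                             ∷ (1 ∷ 2 ∷ 0 ∷ 2 ∷ 2 ∷ 3 ∷ 1 ∷ [])
                             ∷ (1 ∷ 2 ∷ 2 ∷ 0 ∷ 3 ∷ 3 ∷ 3 ∷ [])
                             ∷ (2 ∷ 1 ∷ 2 ∷ 3 ∷ 0 ∷ 2 ∷ 1 ∷ [])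
                             ∷ (2 ∷ 1 ∷ 3 ∷ 3 ∷ 2 ∷ 0 ∷ 3 ∷ [])
                             ∷ (2 ∷ 2 ∷ 1 ∷ 3 ∷ 1 ∷ 3 ∷ 0 ∷ [])
                             ∷ []

  C₅-with-pendants-distance : Fin 7 → Fin 7 → ℕ
  C₅-with-pendants-distance i j = lookup (lookup C₅-with-pendants-distances i) j

  open DistanceCertificate C₅-with-pendants oneComponent C₅-with-pendants-distance

  C₅-with-pendants-connected : Connected C₅-with-pendants
  C₅-with-pendants-connected = connected-decided (λ _ _ → refl)

  gp-C₅-with-pendants : IsGP C₅-with-pendants 4
  gp-C₅-with-pendants =
    isGP-decided (outside ∷ outside ∷ inside ∷ inside ∷ inside ∷ inside ∷ outside ∷ [])

gp-C₅-with-pendants-01 : IsGP (deleteEdge C₅-with-pendants (# 0) (# 1)) 2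
gp-C₅-with-pendants-01 =
  isGP-decided (outside ∷ outside ∷ outside ∷ inside ∷ outside ∷ inside ∷ outside ∷ [])
  where
  -- Deleting 01 leaves the path 3 - 0 - 2 - 6 - 4 - 1 - 5.
  position : Fin 7 → ℕ
  position i = lookup (1 ∷ 5 ∷ 2 ∷ 0 ∷ 4 ∷ 6 ∷ 3 ∷ []) i
  open DistanceCertificate (deleteEdge C₅-with-pendants (# 0) (# 1)) oneComponent (pathDistance position)

theorem6p2 : ((G : Graph) → Connected G → (a b : Vertex G) → IsEdge G a b →
                ∀ (k m : ℕ) → IsGP G k → IsGP (deleteEdge G a b) m →
                (k ≤ 2 * m) × (m ≤ 2 * k))
           × (Σ Graph λ G → Connected G × Σ (Vertex G) λ a → Σ (Vertex G) λ b →
                IsEdge G a b × Σ ℕ λ k → Σ ℕ λ m →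
                IsGP G k × IsGP (deleteEdge G a b) m × (k ≡ 2 * m))
           × (Σ Graph λ G → Connected G × Σ (Vertex G) λ a → Σ (Vertex G) λ b →
                IsEdge G a b × Σ ℕ λ k → Σ ℕ λ m →
                IsGP G k × IsGP (deleteEdge G a b) m × (m ≡ 2 * k))
theorem6p2 =
    (λ G conn a b _ → gp-deleteEdge-bounds G conn a b)
  , (C₅-with-pendants , C₅-with-pendants-connected , # 0 , # 1 , refl
    , 4 , 2 , gp-C₅-with-pendants , gp-C₅-with-pendants-01 , refl)
  , (P₄ , P₄-connected , # 1 , # 2 , refl , 2 , 4 , gp-P₄ , gp-P₄-12 , refl)
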